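{- Let $A$ be a set of actions containing $\tau$, $(S,\to)$ a labelled transition system with labels from $A$, and $\mathcal C$ a colouring of $S$ such that any two states with the same colour have the same $\mathcal C$-coloured traces of length three (i.e. of the form colour, action, colour). Then $\mathcal C$ is consistent.
   Context: $s\xrightarrow{a}s'$ means $(s,a,s')\in\to$. A path from $s$ is a sequence $s_0,a_1,s_1,\dots,a_n,s_n$ with $s_0=s$ and $s_{k-1}\xrightarrow{a_k}s_k$ for $k=1,\dots,n$. A colouring is an equivalence relation $\mathcal C$ on $S$; $\mathcal C(s)$ is the class of $s$. For a path $\pi=s_0,a_1,\dots,a_n,s_n$, $\mathcal C(\pi)$ is obtained from $\mathcal C(s_0),a_1,\mathcal C(s_1),\dots,a_n,\mathcal C(s_n)$ by contracting every subsequence of the form $C,\tau,C,\tau,\dots,\tau,C$ to $C$; it is called a $\mathcal C$-coloured trace of $s_0$. $\mathcal C$ is consistent if any two states of the same colour have the same $\mathcal C$-coloured traces. -}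

module Defs where

open import Data.List using (List; []; _∷_; [_])
open import Data.List.Relation.Binary.Pointwise using (Pointwise)
open import Data.Product using (Σ; _×_; _,_)
open import Relation.Binary.PropositionalEquality using (_≡_)
open import Relation.Nullary using (¬_)
open import Function.Bundles using (_⇔_)

-- A labelled transition system (S, →) with labels from A, τ ∈ A,
-- and a colouring given as a relation _≈_ on S (assumed an equivalence
-- relation in the theorem).  Colour classes are represented by states
-- (representatives); colour sequences are compared up to _≈_.
module LTS (A : Set) (τ : A) (S : Set) (_⟶[_]_ : S → A → S → Set)
           (_≈_ : S → S → Set) where

  data Path : S → List (A × S) → Set where
    nil  : ∀ {s} → Path s []
    cons : ∀ {s a s' rest} → s ⟶[ a ] s' → Path s' rest →
           Path s ((a , s') ∷ rest)

  -- Contraction of C(s₀), a₁, C(s₁), …, aₙ, C(sₙ): every maximal block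
  -- C, τ, C, τ, …, τ, C is contracted to C.  `Contr c raw out` says that
  -- the sequence starting with the colour of c followed by raw contracts
  -- to the colour of c followed by out.
  data Contr : S → List (A × S) → List (A × S) → Set where
    done : ∀ {c} → Contr c [] []
    skip : ∀ {c s rest out} → c ≈ s → Contr c rest out →
           Contr c ((τ , s) ∷ rest) out
    keep : ∀ {c a s rest out} → ¬ (a ≡ τ × c ≈ s) → Contr s rest out →
           Contr c ((a , s) ∷ rest) ((a , s) ∷ out)

  ColTrace : Set
  ColTrace = S × List (A × S)

  SameStep : (A × S) → (A × S) → Set
  SameStep (a , x) (b , y) = a ≡ b × x ≈ y

  HasTrace : S → ColTrace → Set
  HasTrace s (c , σ) =
    Σ (List (A × S)) λ raw → Path s raw ×
    Σ (List (A × S)) λ out → Contr s raw out ×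
    (c ≈ s × Pointwise SameStep σ out)

  Consistent : Set
  Consistent = ∀ s t → s ≈ t → ∀ (σ : ColTrace) → HasTrace s σ ⇔ HasTrace t σ

  Consistent3 : Set
  Consistent3 = ∀ s t → s ≈ t → ∀ (c : S) (a : A) (d : S) →
    HasTrace s (c , [ (a , d) ]) ⇔ HasTrace t (c , [ (a , d) ])

-- A path from s is matched by a path from t ≈ s step by step along its
-- contraction: a τ-step that keeps the colour is simply skipped, and a visible
-- step p ⟶[ a ] s₁ (with p ≈ the current state of the other path) is answered,
-- by consistency on traces of length three, with a path whose contraction is the
-- single step (a , s₂) with s₁ ≈ s₂; the rest of the path is matched from s₂.

module Submission where

open import Defs
open import Relation.Binary.Structures using (IsEquivalence)
open import Data.List using (List; []; _∷_; [_])
open import Data.List.Relation.Binary.Pointwise using (Pointwise; []; _∷_; transitive)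
open import Data.Product using (Σ; _×_; _,_)
open import Relation.Binary.PropositionalEquality using (_≡_; refl; trans)
open import Relation.Nullary using (¬_)
open import Function.Bundles using (mk⇔; Equivalence)

module Consistency (A : Set) (τ : A) (S : Set) (_⟶[_]_ : S → A → S → Set)
    (_≈_ : S → S → Set) (≈-isEquivalence : IsEquivalence _≈_) where
  open LTS A τ S _⟶[_]_ _≈_
  open IsEquivalence ≈-isEquivalence renaming (refl to ≈-refl; sym to ≈-sym; trans to ≈-trans)

  Contr-resp : ∀ {c c' raw out} → c ≈ c' → Contr c raw out → Contr c' raw out
  Contr-resp c≈c' done = done
  Contr-resp c≈c' (skip c≈s k) = skip (≈-trans (≈-sym c≈c') c≈s) (Contr-resp c≈c' k)
  Contr-resp c≈c' (keep visible k) =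
    keep (λ { (a≡τ , c'≈s) → visible (a≡τ , ≈-trans c≈c' c'≈s) }) k

  SameStep-trans : ∀ {x y z} → SameStep x y → SameStep y z → SameStep x z
  SameStep-trans (a≡b , x≈y) (b≡c , y≈z) = trans a≡b b≡c , ≈-trans x≈y y≈z

  -- A path contracting to a single visible step is cut right after that step.
  Contr-splice : ∀ {c t raw a s rest out} →
    Path t raw → Contr c raw [ (a , s) ] → Path s rest → Contr s rest out →
    Σ (List (A × S)) λ raw' → Path t raw' × Contr c raw' ((a , s) ∷ out)
  Contr-splice (cons step path) (skip c≈s k) path' k'
    with Contr-splice path k path' k'
  ... | raw' , path″ , k″ = _ , cons step path″ , skip c≈s k″
  Contr-splice (cons step _) (keep visible _) path' k' =
    _ , cons step path' , keep visible k'

  module _ (consistent3 : Consistent3) where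

    visible-step-match : ∀ {p t a s} → p ≈ t → p ⟶[ a ] s → ¬ (a ≡ τ × p ≈ s) →
      Σ (List (A × S)) λ raw → Path t raw ×
      Σ S λ s' → Contr t raw [ (a , s') ] × s ≈ s'
    visible-step-match {p} {t} {a} {s} p≈t step visible
      with Equivalence.to (consistent3 p t p≈t p a s)
             (_ , cons step nil , _ , keep visible done , ≈-refl , (refl , ≈-refl) ∷ [])
    ... | raw , path , (.a , s') ∷ [] , k , _ , (refl , s≈s') ∷ [] =
      raw , path , s' , k , s≈s'

    simulate : ∀ {p t raw out} → p ≈ t → Path p raw → Contr p raw out →
      Σ (List (A × S)) λ raw' → Path t raw' ×
      Σ (List (A × S)) λ out' → Contr t raw' out' × Pointwise SameStep out out'
    simulate p≈t nil done = [] , nil , [] , done , []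
    simulate p≈t (cons step path) (skip p≈s k) =
      simulate (≈-trans (≈-sym p≈s) p≈t) path (Contr-resp p≈s k)
    simulate p≈t (cons {a = a} step path) (keep visible k)
      with visible-step-match p≈t step visible
    ... | raw₁ , path₁ , s' , k₁ , s≈s'
      with simulate s≈s' path k
    ... | raw₂ , path₂ , out₂ , k₂ , same
      with Contr-splice path₁ k₁ path₂ k₂
    ... | raw' , path' , k' = raw' , path' , _ , k' , (refl , s≈s') ∷ same

    HasTrace-transfer : ∀ s t → s ≈ t → ∀ σ → HasTrace s σ → HasTrace t σ
    HasTrace-transfer s t s≈t (c , σ) (raw , path , out , k , c≈s , same)
      with simulate s≈t path k
    ... | raw' , path' , out' , k' , same' =
      raw' , path' , out' , k' , ≈-trans c≈s s≈t , transitive SameStep-trans same same'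

    consistent : Consistent
    consistent s t s≈t σ =
      mk⇔ (HasTrace-transfer s t s≈t σ) (HasTrace-transfer t s (≈-sym s≈t) σ)

lemma11 : (A : Set) (τ : A) (S : Set) (_⟶[_]_ : S → A → S → Set)
          (_≈_ : S → S → Set) → IsEquivalence _≈_ →
          LTS.Consistent3 A τ S _⟶[_]_ _≈_ →
          LTS.Consistent A τ S _⟶[_]_ _≈_
lemma11 A τ S _⟶[_]_ _≈_ ≈-isEquivalence =
  Consistency.consistent A τ S _⟶[_]_ _≈_ ≈-isEquivalence
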